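{- Let $G$ be a minimal counterexample (as defined in the context). Then $G$ contains no $4^+$-path, i.e. there is no path $v_0v_1\cdots v_{k+1}$ with $k\geq 4$ whose internal vertices $v_1,\dots,v_k$ all have degree $2$ in $G$.
   Context: A $2$-distance $k$-coloring of a graph assigns colors from $\{1,\dots,k\}$ so that distinct vertices at distance at most $2$ get different colors. A minimal counterexample is a finite simple graph $G$ with $\mathrm{mad}(G)\leq 18/7$ (equivalently $9|A|-7|E(G[A])|\geq 0$ for all $A\subseteq V(G)$), maximum degree $\Delta(G)=7$, that has no $2$-distance $8$-coloring, and such that every graph $H$ with $\mathrm{mad}(H)\leq 18/7$, maximum degree at most $7$ and $|V(H)|+|E(H)|<|V(G)|+|E(G)|$ has a $2$-distance $8$-coloring. A $k$-path is a path of length $k+1$ whose $k$ internal vertices are $2$-vertices (vertices of degree $2$ in $G$); a $k^+$-path is a $j$-path for some $j\geq k$. -}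

module Defs where

open import Data.Nat using (ℕ; zero; suc; _+_; _*_; _≤_; _<_; _<ᵇ_)
open import Data.Fin using (Fin; zero; suc; toℕ; inject₁)
open import Data.Bool using (Bool; true; false; _∧_; if_then_else_)
open import Data.Product using (Σ; ∃; _×_; _,_)
open import Data.Sum using (_⊎_)
open import Relation.Nullary using (¬_)
open import Relation.Binary.PropositionalEquality using (_≡_; _≢_)

record Graph (n : ℕ) : Set where
  field
    adj    : Fin n → Fin n → Bool
    sym    : ∀ u v → adj u v ≡ adj v u
    irrefl : ∀ v → adj v v ≡ false
open Graph public

Adj : ∀ {n} → Graph n → Fin n → Fin n → Set
Adj G u v = adj G u v ≡ true

count : ∀ {n} → (Fin n → Bool) → ℕ
count {zero}  p = 0
count {suc n} p = (if p zero then 1 else 0) + count (λ i → p (suc i))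

sumF : ∀ {n} → (Fin n → ℕ) → ℕ
sumF {zero}  f = 0
sumF {suc n} f = f zero + sumF (λ i → f (suc i))

deg : ∀ {n} → Graph n → Fin n → ℕ
deg G v = count (adj G v)

VSubset : ℕ → Set
VSubset n = Fin n → Bool

-- |E(G[A])|: unordered pairs {i,j} (counted once, i < j) inside A that are adjacent
edgesIn : ∀ {n} → Graph n → VSubset n → ℕ
edgesIn G A = sumF (λ i → count (λ j → A i ∧ A j ∧ adj G i j ∧ (toℕ i <ᵇ toℕ j)))

numEdges : ∀ {n} → Graph n → ℕ
numEdges G = edgesIn G (λ _ → true)

-- mad(G) ≤ 18/7, in the equivalent form 9|A| - 7|E(G[A])| ≥ 0 for all A ⊆ V(G)
MadLe18/7 : ∀ {n} → Graph n → Set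
MadLe18/7 {n} G = (A : VSubset n) → 7 * edgesIn G A ≤ 9 * count A

MaxDegLe : ∀ {n} → Graph n → ℕ → Set
MaxDegLe G d = ∀ v → deg G v ≤ d

MaxDegEq : ∀ {n} → Graph n → ℕ → Set
MaxDegEq G d = MaxDegLe G d × ∃ λ v → deg G v ≡ d

Dist≤2 : ∀ {n} → Graph n → Fin n → Fin n → Set
Dist≤2 G u v = Adj G u v ⊎ (∃ λ w → Adj G u w × Adj G w v)

TwoDistColoring : ∀ {n} → Graph n → ℕ → Set
TwoDistColoring {n} G k =
  Σ (Fin n → Fin k) λ c → ∀ u v → u ≢ v → Dist≤2 G u v → c u ≢ c v

MinimalCounterexample : ∀ {n} → Graph n → Set
MinimalCounterexample {n} G =
  MadLe18/7 G × MaxDegEq G 7 × ¬ TwoDistColoring G 8 ×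
  (∀ (m : ℕ) (H : Graph m) → MadLe18/7 H → MaxDegLe H 7 →
     m + numEdges H < n + numEdges G → TwoDistColoring H 8)

record KPath {n} (G : Graph n) (k : ℕ) : Set where
  field
    vtx       : Fin (suc (suc k)) → Fin n
    injective : ∀ i j → vtx i ≡ vtx j → i ≡ j
    consec    : ∀ (i : Fin (suc k)) → Adj G (vtx (inject₁ i)) (vtx (suc i))
    internal  : ∀ (i : Fin k) → deg G (vtx (suc (inject₁ i))) ≡ 2

-- Take the first six vertices v₀ … v₅ of a 4⁺-path and delete the edge v₂v₃. The smaller graph
-- still has mad ≤ 18/7 and maximum degree ≤ 7, so by minimality it has a 2-distance 8-colouring.
-- Since v₁, …, v₄ have degree 2, every vertex within distance 2 of v₂ or v₃ lies on the path,
-- and no pair of other vertices at distance ≤ 2 is linked through the edge v₂v₃. Recolouring v₂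
-- away from the colours of v₀, v₁, v₄, and then v₃ away from those of v₁, v₂, v₄, v₅, therefore
-- gives a 2-distance 8-colouring of G, a contradiction: at most four colours are ever excluded.
module Submission where

open import Defs
open import Data.Nat using (ℕ; zero; suc; _+_; _≤_; _<_; _<ᵇ_; z≤n; s≤s; z<s; s<s)
open import Data.Nat.Properties
  using (≤-trans; m≤n⇒m≤1+n; +-suc; +-mono-≤; +-mono-<-≤; +-mono-≤-<; +-monoʳ-<; *-monoʳ-≤; <⇒<ᵇ; <-cmp; <⇒≱)
open import Data.Fin using (Fin; zero; suc; toℕ; inject₁; _↑ˡ_)
open import Data.Fin.Properties using (_≟_; any?; ¬∀⟶∃¬; injective⇒≤; ↑ˡ-injective; suc-injective; toℕ-injective)
open import Data.Fin.Literals renaming (number to finNumber)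
open import Data.Nat.Literals renaming (number to natNumber)
open import Data.Unit using (tt)
open import Agda.Builtin.FromNat using (Number; fromNat)
open import Data.Vec using ([]; _∷_; lookup)
open import Data.Vec.Functional using (updateAt)
open import Data.Vec.Functional.Properties using (updateAt-updates; updateAt-minimal)
open import Data.Bool using (Bool; true; false; _∧_; _∨_; not; if_then_else_)
open import Data.Bool.Properties using (∧-identityʳ; ∧-zeroʳ; ∧-conicalˡ; ∧-comm; ∨-zeroʳ; T-≡)
open import Data.Product using (∃; _,_; proj₁; proj₂; map₂)
open import Data.Sum using (_⊎_; inj₁; inj₂)
open import Function using (_∘_; const; Equivalence)
open import Relation.Nullary using (¬_; does; yes; no; contradiction)
open import Relation.Nullary.Decidable using (dec-true; dec-false)
open import Relation.Binary using (tri<; tri≈; tri>)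
open import Relation.Binary.PropositionalEquality using (_≡_; _≢_; ≢-sym; refl; trans; cong; cong₂; subst)
  renaming (sym to ≡-sym)

instance
  ℕ-number : Number ℕ
  ℕ-number = natNumber
  Fin-number : ∀ {n} → Number (Fin n)
  Fin-number {n} = finNumber n

count-cong : ∀ {n} (p q : Fin n → Bool) → (∀ i → p i ≡ q i) → count p ≡ count q
count-cong {zero}  p q p≗q = refl
count-cong {suc n} p q p≗q =
  cong₂ _+_ (cong (λ b → if b then 1 else 0) (p≗q zero)) (count-cong (p ∘ suc) (q ∘ suc) (p≗q ∘ suc))

remove : ∀ {n} → (Fin n → Bool) → Fin n → Fin n → Bool
remove p a x = p x ∧ not (does (x ≟ a))

remove-true : ∀ {n} (p : Fin n → Bool) {a x} → p x ≡ true → x ≢ a → remove p a x ≡ true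
remove-true p {a} {x} px x≢a rewrite px | dec-false (x ≟ a) x≢a = refl

count-remove : ∀ {n} (p : Fin n → Bool) (a : Fin n) → p a ≡ true → count p ≡ suc (count (remove p a))
count-remove p zero pa rewrite pa =
  cong suc (count-cong (p ∘ suc) (remove p zero ∘ suc) (≡-sym ∘ ∧-identityʳ ∘ p ∘ suc))
count-remove p (suc a) pa
  rewrite count-remove (p ∘ suc) a pa | ∧-identityʳ (p zero) = +-suc _ _

count≡2-unique : ∀ {n} (p : Fin n → Bool) {a b y} → count p ≡ 2 →
  p a ≡ true → p b ≡ true → a ≢ b → p y ≡ true → y ≡ a ⊎ y ≡ b
count≡2-unique p {a} {b} {y} count≡2 pa pb a≢b py with y ≟ a | y ≟ b
... | yes y≡a | _       = inj₁ y≡a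
... | no _    | yes y≡b = inj₂ y≡b
... | no y≢a  | no y≢b = contradiction (trans (≡-sym count≡2) count≥3) λ ()
  where
  p₁ = remove p a
  p₂ = remove p₁ b
  count≥3 : count p ≡ suc (suc (suc (count (remove p₂ y))))
  count≥3 =
    trans (count-remove p a pa)
    (cong suc (trans (count-remove p₁ b (remove-true p pb (a≢b ∘ ≡-sym)))
              (cong suc (count-remove p₂ y (remove-true p₁ (remove-true p py y≢a) y≢b)))))

count-mono : ∀ {n} (p q : Fin n → Bool) → (∀ i → p i ≡ true → q i ≡ true) → count p ≤ count q
count-mono {zero}  p q p⇒q = z≤n
count-mono {suc n} p q p⇒q with p zero in p0 | q zero in q0
... | true  | true  = s≤s (count-mono (p ∘ suc) (q ∘ suc) (p⇒q ∘ suc))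
... | true  | false with () ← trans (≡-sym (p⇒q zero p0)) q0
... | false | true  = m≤n⇒m≤1+n (count-mono (p ∘ suc) (q ∘ suc) (p⇒q ∘ suc))
... | false | false = count-mono (p ∘ suc) (q ∘ suc) (p⇒q ∘ suc)

count-< : ∀ {n} (p q : Fin n → Bool) → (∀ i → p i ≡ true → q i ≡ true) →
  (a : Fin n) → q a ≡ true → p a ≡ false → count p < count q
count-< p q p⇒q a qa pa rewrite count-remove q a qa =
  s≤s (count-mono p (remove q a) λ i pi → remove-true q (p⇒q i pi) λ { refl → contradiction (trans (≡-sym pi) pa) λ () })

sumF-mono : ∀ {n} (f g : Fin n → ℕ) → (∀ i → f i ≤ g i) → sumF f ≤ sumF g
sumF-mono {zero}  f g f≤g = z≤n
sumF-mono {suc n} f g f≤g = +-mono-≤ (f≤g zero) (sumF-mono (f ∘ suc) (g ∘ suc) (f≤g ∘ suc))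

sumF-< : ∀ {n} (f g : Fin n → ℕ) → (∀ i → f i ≤ g i) → (a : Fin n) → f a < g a → sumF f < sumF g
sumF-< f g f≤g zero    fa<ga = +-mono-<-≤ fa<ga (sumF-mono (f ∘ suc) (g ∘ suc) (f≤g ∘ suc))
sumF-< f g f≤g (suc a) fa<ga = +-mono-≤-< (f≤g zero) (sumF-< (f ∘ suc) (g ∘ suc) (f≤g ∘ suc) a fa<ga)

-- A map Fin k → Fin m hit by every element would have an injective right inverse Fin m → Fin k.
<⇒∃-notInImage : ∀ {k m} → k < m → (f : Fin k → Fin m) → ∃ λ a → ∀ i → f i ≢ a
<⇒∃-notInImage {k} {m} k<m f
  = map₂ (λ a∉f i fi≡a → a∉f (i , fi≡a))
         (¬∀⟶∃¬ m (λ a → ∃ λ i → f i ≡ a) (λ a → any? λ i → f i ≟ a) notSurjective)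
  where
  notSurjective : ¬ (∀ a → ∃ λ i → f i ≡ a)
  notSurjective surj = <⇒≱ k<m (injective⇒≤ {f = proj₁ ∘ surj} λ {a} {b} eq →
    trans (≡-sym (proj₂ (surj a))) (trans (cong f eq) (proj₂ (surj b))))

Adj-sym : ∀ {n} (G : Graph n) {u v} → Adj G u v → Adj G v u
Adj-sym G {u} {v} uv = trans (Graph.sym G v u) uv

Adj⇒≢ : ∀ {n} (G : Graph n) {u v} → Adj G u v → u ≢ v
Adj⇒≢ G {u} uv refl with () ← trans (≡-sym uv) (irrefl G u)

Dist≤2-sym : ∀ {n} (G : Graph n) {u v} → Dist≤2 G u v → Dist≤2 G v u
Dist≤2-sym G (inj₁ uv)            = inj₁ (Adj-sym G uv)
Dist≤2-sym G (inj₂ (w , uw , wv)) = inj₂ (w , Adj-sym G wv , Adj-sym G uw)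

infix 4 _⊆ᴳ_
_⊆ᴳ_ : ∀ {n} → Graph n → Graph n → Set
H ⊆ᴳ G = ∀ u v → Adj H u v → Adj G u v

∧-mono₃ : ∀ a b c {x y} → (x ≡ true → y ≡ true) → a ∧ b ∧ x ∧ c ≡ true → a ∧ b ∧ y ∧ c ≡ true
∧-mono₃ true  true  c {true}  x⇒y h rewrite x⇒y refl = h
∧-mono₃ true  true  c {false} x⇒y ()
∧-mono₃ true  false c         x⇒y ()
∧-mono₃ false b     c         x⇒y ()

module _ {n} {H G : Graph n} (H⊆G : H ⊆ᴳ G) where

  edgesAt-mono : ∀ (A : VSubset n) i → count (λ j → A i ∧ A j ∧ adj H i j ∧ (toℕ i <ᵇ toℕ j))
                       ≤ count (λ j → A i ∧ A j ∧ adj G i j ∧ (toℕ i <ᵇ toℕ j))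
  edgesAt-mono A i = count-mono _ _ λ j → ∧-mono₃ (A i) (A j) _ (H⊆G i j)

  edgesIn-mono : ∀ (A : VSubset n) → edgesIn H A ≤ edgesIn G A
  edgesIn-mono A = sumF-mono _ _ (edgesAt-mono A)

  ⊆ᴳ-mad : MadLe18/7 G → MadLe18/7 H
  ⊆ᴳ-mad madG A = ≤-trans (*-monoʳ-≤ 7 (edgesIn-mono A)) (madG A)

  ⊆ᴳ-maxDeg : ∀ {d} → MaxDegLe G d → MaxDegLe H d
  ⊆ᴳ-maxDeg maxG v = ≤-trans (count-mono _ _ (H⊆G v)) (maxG v)

  -- numEdges counts the edge {x, y} once, in the row of its smaller endpoint x
  numEdges-<-ordered : ∀ {x y} → toℕ x < toℕ y → Adj G x y → adj H x y ≡ false → numEdges H < numEdges G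
  numEdges-<-ordered {x} {y} x<y xy x≁y =
    sumF-< _ _ (edgesAt-mono (const true)) x (count-< _ _ (λ j → ∧-mono₃ true true _ (H⊆G x j)) y inG inH)
    where
    inG : true ∧ true ∧ adj G x y ∧ (toℕ x <ᵇ toℕ y) ≡ true
    inG rewrite xy = Equivalence.to T-≡ (<⇒<ᵇ x<y)
    inH : true ∧ true ∧ adj H x y ∧ (toℕ x <ᵇ toℕ y) ≡ false
    inH rewrite x≁y = refl

  numEdges-< : ∀ {x y} → Adj G x y → adj H x y ≡ false → numEdges H < numEdges G
  numEdges-< {x} {y} xy x≁y with <-cmp (toℕ x) (toℕ y)
  ... | tri< x<y _ _ = numEdges-<-ordered x<y xy x≁y
  ... | tri≈ _ x≡y _ = contradiction (toℕ-injective x≡y) (Adj⇒≢ G xy)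
  ... | tri> _ _ y<x = numEdges-<-ordered y<x (Adj-sym G xy) (trans (Graph.sym H y x) x≁y)

endpoint : ∀ {n} → Fin n → Fin n → Fin n → Bool
endpoint a b x = does (x ≟ a) ∨ does (x ≟ b)

-- every edge with both ends in {a, b} is removed; by irreflexivity that is just ab
deleteEdge : ∀ {n} → Graph n → Fin n → Fin n → Graph n
deleteEdge G a b = record
  { adj    = λ u v → adj G u v ∧ not (endpoint a b u ∧ endpoint a b v)
  ; sym    = λ u v → cong₂ (λ e f → e ∧ not f) (Graph.sym G u v) (∧-comm (endpoint a b u) _)
  ; irrefl = λ v → cong (_∧ _) (irrefl G v)
  }

module _ {n} (G : Graph n) (a b : Fin n) where

  deleteEdge-⊆ᴳ : deleteEdge G a b ⊆ᴳ G
  deleteEdge-⊆ᴳ u v = ∧-conicalˡ _ _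

  deleteEdge-removes : adj (deleteEdge G a b) a b ≡ false
  deleteEdge-removes
    rewrite dec-true (a ≟ a) refl | dec-true (b ≟ b) refl | ∨-zeroʳ (does (b ≟ a)) = ∧-zeroʳ (adj G a b)

  deleteEdge-keeps : ∀ {u v} → u ≢ a → u ≢ b → Adj G u v → Adj (deleteEdge G a b) u v
  deleteEdge-keeps {u} u≢a u≢b uv rewrite dec-false (u ≟ a) u≢a | dec-false (u ≟ b) u≢b | uv = refl

  deleteEdge-keeps′ : ∀ {u v} → v ≢ a → v ≢ b → Adj G u v → Adj (deleteEdge G a b) u v
  deleteEdge-keeps′ v≢a v≢b uv = Adj-sym (deleteEdge G a b) (deleteEdge-keeps v≢a v≢b (Adj-sym G uv))

  deleteEdge-dist≤2 : ∀ {u v} → u ≢ a → u ≢ b → v ≢ a → v ≢ b →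
    Dist≤2 G u v → Dist≤2 (deleteEdge G a b) u v
  deleteEdge-dist≤2 u≢a u≢b v≢a v≢b (inj₁ uv) = inj₁ (deleteEdge-keeps u≢a u≢b uv)
  deleteEdge-dist≤2 u≢a u≢b v≢a v≢b (inj₂ (w , uw , wv)) =
    inj₂ (w , deleteEdge-keeps u≢a u≢b uw , deleteEdge-keeps′ v≢a v≢b wv)

minimal-deleteEdge-colourable : ∀ {n} {G : Graph n} → MinimalCounterexample G →
  ∀ {a b} → Adj G a b → TwoDistColoring (deleteEdge G a b) 8
minimal-deleteEdge-colourable {n} {G} (madG , (maxG , _) , _ , minimal) {a} {b} ab =
  minimal n H (⊆ᴳ-mad {H = H} {G} H⊆G madG) (⊆ᴳ-maxDeg {H = H} {G} H⊆G maxG)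
    (+-monoʳ-< n (numEdges-< {H = H} {G} H⊆G ab (deleteEdge-removes G a b)))
  where
  H = deleteEdge G a b
  H⊆G : H ⊆ᴳ G
  H⊆G = deleteEdge-⊆ᴳ G a b

≢-via : ∀ {A : Set} {a b x y : A} → a ≡ x → b ≡ y → x ≢ y → a ≢ b
≢-via refl refl x≢y = x≢y

deg≡2-neighbours : ∀ {n} (G : Graph n) {x a b y} → deg G x ≡ 2 →
  Adj G x a → Adj G x b → a ≢ b → Adj G x y → y ≡ a ⊎ y ≡ b
deg≡2-neighbours G {x} = count≡2-unique (adj G x)

module _ {n} {G : Graph n} where

  KPath-distinct : ∀ {k} (P : KPath G k) {i j} → i ≢ j → KPath.vtx P i ≢ KPath.vtx P j
  KPath-distinct P i≢j = i≢j ∘ KPath.injective P _ _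

  KPath-tail : ∀ {k} → KPath G (suc k) → KPath G k
  KPath-tail P = record
    { vtx       = vtx ∘ suc
    ; injective = λ i j → suc-injective ∘ injective (suc i) (suc j)
    ; consec    = consec ∘ suc
    ; internal  = internal ∘ suc
    }
    where open KPath P

  KPath-prefix : ∀ j k → KPath G (j + k) → KPath G j
  KPath-prefix j k P = record
    { vtx       = λ i → vtx (i ↑ˡ k)
    ; injective = λ i i′ → ↑ˡ-injective k i i′ ∘ injective _ _
    ; consec    = λ i → subst (λ z → Adj G (vtx z) (vtx (suc i ↑ˡ k))) (≡-sym (inject₁-↑ˡ i k)) (consec (i ↑ˡ k))
    ; internal  = λ i → subst (λ z → deg G (vtx (suc z)) ≡ 2) (≡-sym (inject₁-↑ˡ i k)) (internal (i ↑ˡ k))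
    }
    where
    open KPath P
    inject₁-↑ˡ : ∀ {m} (i : Fin m) k → inject₁ i ↑ˡ k ≡ inject₁ (i ↑ˡ k)
    inject₁-↑ˡ zero    k = refl
    inject₁-↑ˡ (suc i) k = cong suc (inject₁-↑ˡ i k)

module KPath₃ {n} {G : Graph n} (Q : KPath G 3) where
  open KPath Q

  private
    N₁ : ∀ {y} → Adj G (vtx 1) y → y ≡ vtx 0 ⊎ y ≡ vtx 2
    N₁ = deg≡2-neighbours G (internal 0) (Adj-sym G (consec 0)) (consec 1) (KPath-distinct Q λ ())
    N₂ : ∀ {y} → Adj G (vtx 2) y → y ≡ vtx 1 ⊎ y ≡ vtx 3
    N₂ = deg≡2-neighbours G (internal 1) (Adj-sym G (consec 1)) (consec 2) (KPath-distinct Q λ ())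
    N₃ : ∀ {y} → Adj G (vtx 3) y → y ≡ vtx 2 ⊎ y ≡ vtx 4
    N₃ = deg≡2-neighbours G (internal 2) (Adj-sym G (consec 2)) (consec 3) (KPath-distinct Q λ ())

  dist≤2-middle : ∀ {v} → v ≢ vtx 2 → Dist≤2 G (vtx 2) v → v ≡ vtx 0 ⊎ v ≡ vtx 1 ⊎ v ≡ vtx 3 ⊎ v ≡ vtx 4
  dist≤2-middle v≢v₂ (inj₁ e) with N₂ e
  ... | inj₁ refl = inj₂ (inj₁ refl)
  ... | inj₂ refl = inj₂ (inj₂ (inj₁ refl))
  dist≤2-middle v≢v₂ (inj₂ (w , e₁ , e₂)) with N₂ e₁
  dist≤2-middle v≢v₂ (inj₂ (w , e₁ , e₂)) | inj₁ refl with N₁ e₂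
  ... | inj₁ refl = inj₁ refl
  ... | inj₂ refl = contradiction refl v≢v₂
  dist≤2-middle v≢v₂ (inj₂ (w , e₁ , e₂)) | inj₂ refl with N₃ e₂
  ... | inj₁ refl = contradiction refl v≢v₂
  ... | inj₂ refl = inj₂ (inj₂ (inj₂ refl))

module Recolour {n} {G : Graph n} (P : KPath G 4) (c : Fin n → Fin 8)
  (c-ok : ∀ u v → u ≢ v → Dist≤2 (deleteEdge G (KPath.vtx P 2) (KPath.vtx P 3)) u v → c u ≢ c v) where
  open KPath P

  private
    distinct : ∀ {i j} → i ≢ j → vtx i ≢ vtx j
    distinct = KPath-distinct P

  -- abstract: unfolding the witnesses would make type checking evaluate the pigeonhole search
  abstract
    α-fresh : ∃ λ α → ∀ i → lookup (c (vtx 0) ∷ c (vtx 1) ∷ c (vtx 4) ∷ []) i ≢ α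
    α-fresh = <⇒∃-notInImage (s<s (s<s (s<s z<s))) _

  α : Fin 8
  α = proj₁ α-fresh

  abstract
    β-fresh : ∃ λ β → ∀ i → lookup (c (vtx 1) ∷ α ∷ c (vtx 4) ∷ c (vtx 5) ∷ []) i ≢ β
    β-fresh = <⇒∃-notInImage (s<s (s<s (s<s (s<s z<s)))) _

  β : Fin 8
  β = proj₁ β-fresh

  c′ : Fin n → Fin 8
  c′ = updateAt (updateAt c (vtx 3) (const β)) (vtx 2) (const α)

  c′-v₂ : c′ (vtx 2) ≡ α
  c′-v₂ = updateAt-updates (vtx 2) _

  c′-v₃ : c′ (vtx 3) ≡ β
  c′-v₃ = trans (updateAt-minimal (vtx 3) (vtx 2) _ (distinct λ ())) (updateAt-updates (vtx 3) c)

  c′-other : ∀ {x} → x ≢ vtx 2 → x ≢ vtx 3 → c′ x ≡ c x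
  c′-other {x} x≢v₂ x≢v₃ =
    trans (updateAt-minimal x (vtx 2) _ x≢v₂) (updateAt-minimal x (vtx 3) c x≢v₃)

  c′-v₂-ok : ∀ {v} → v ≢ vtx 2 → Dist≤2 G (vtx 2) v → c′ (vtx 2) ≢ c′ v
  c′-v₂-ok v≢v₂ d with KPath₃.dist≤2-middle (KPath-prefix 3 1 P) v≢v₂ d
  ... | inj₁ refl                 = ≢-via c′-v₂ (c′-other (distinct λ ()) (distinct λ ())) (≢-sym (proj₂ α-fresh 0))
  ... | inj₂ (inj₁ refl)          = ≢-via c′-v₂ (c′-other (distinct λ ()) (distinct λ ())) (≢-sym (proj₂ α-fresh 1))
  ... | inj₂ (inj₂ (inj₁ refl))   = ≢-via c′-v₂ c′-v₃ (proj₂ β-fresh 1)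
  ... | inj₂ (inj₂ (inj₂ refl))   = ≢-via c′-v₂ (c′-other (distinct λ ()) (distinct λ ())) (≢-sym (proj₂ α-fresh 2))

  c′-v₃-ok : ∀ {v} → v ≢ vtx 3 → Dist≤2 G (vtx 3) v → c′ (vtx 3) ≢ c′ v
  c′-v₃-ok v≢v₃ d with KPath₃.dist≤2-middle (KPath-tail P) v≢v₃ d
  ... | inj₁ refl                 = ≢-via c′-v₃ (c′-other (distinct λ ()) (distinct λ ())) (≢-sym (proj₂ β-fresh 0))
  ... | inj₂ (inj₁ refl)          = ≢-via c′-v₃ c′-v₂ (≢-sym (proj₂ β-fresh 1))
  ... | inj₂ (inj₂ (inj₁ refl))   = ≢-via c′-v₃ (c′-other (distinct λ ()) (distinct λ ())) (≢-sym (proj₂ β-fresh 2))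
  ... | inj₂ (inj₂ (inj₂ refl))   = ≢-via c′-v₃ (c′-other (distinct λ ()) (distinct λ ())) (≢-sym (proj₂ β-fresh 3))

  c′-ok : ∀ u v → u ≢ v → Dist≤2 G u v → c′ u ≢ c′ v
  c′-ok u v u≢v d with u ≟ vtx 2 | u ≟ vtx 3 | v ≟ vtx 2 | v ≟ vtx 3
  ... | yes refl | _        | _        | _        = c′-v₂-ok (u≢v ∘ ≡-sym) d
  ... | no _     | yes refl | _        | _        = c′-v₃-ok (u≢v ∘ ≡-sym) d
  ... | no u≢v₂  | no _     | yes refl | _        = ≢-sym (c′-v₂-ok u≢v₂ (Dist≤2-sym G d))
  ... | no _     | no u≢v₃  | no _     | yes refl = ≢-sym (c′-v₃-ok u≢v₃ (Dist≤2-sym G d))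
  ... | no u≢v₂  | no u≢v₃  | no v≢v₂  | no v≢v₃  =
    ≢-via (c′-other u≢v₂ u≢v₃) (c′-other v≢v₂ v≢v₃)
      (c-ok u v u≢v (deleteEdge-dist≤2 G _ _ u≢v₂ u≢v₃ v≢v₂ v≢v₃ d))

  colouring : TwoDistColoring G 8
  colouring = c′ , c′-ok

extend-colouring : ∀ {n} {G : Graph n} (P : KPath G 4) →
  TwoDistColoring (deleteEdge G (KPath.vtx P 2) (KPath.vtx P 3)) 8 → TwoDistColoring G 8
extend-colouring P (c , c-ok) = Recolour.colouring P c c-ok

no-4-path : ∀ {n} {G : Graph n} → MinimalCounterexample G → ¬ KPath G 4
no-4-path {G = G} mc@(_ , _ , uncolourable , _) P =
  uncolourable (extend-colouring P (minimal-deleteEdge-colourable {G = G} mc (KPath.consec P 2)))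

lemma6 : ∀ {n} (G : Graph n) → MinimalCounterexample G →
    ∀ (k : ℕ) → 4 ≤ k → ¬ KPath G k
lemma6 G mc (suc (suc (suc (suc k)))) (s≤s (s≤s (s≤s (s≤s _)))) = no-4-path mc ∘ KPath-prefix 4 k
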